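{- If $q>3$ is an odd prime power, then every $2$-primitive element of $\mathbb{F}_{q^2}$ is normal over $\mathbb{F}_q$. In contrast, every $2$-primitive element of $\mathbb{F}_{3^2}$ is $1$-normal over $\mathbb{F}_3$.
   Context: An element $\alpha\in\mathbb{F}_{q^2}$ is normal over $\mathbb{F}_q$ if $\{\alpha,\alpha^q\}$ is an $\mathbb{F}_q$-basis of $\mathbb{F}_{q^2}$, and $1$-normal if $\alpha,\alpha^q$ span a $1$-dimensional $\mathbb{F}_q$-space. An element of $\mathbb{F}_{q^2}^*$ is $2$-primitive if its multiplicative order is $(q^2-1)/2$. -}

module Defs where

open import Level using (Level; _⊔_)
open import Data.Nat using (ℕ; zero; suc; _<_; _≤_)
import Data.Nat as N
open import Data.Nat.Primality using (Prime)
open import Data.Fin using (Fin)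
open import Data.Product using (Σ; ∃; _×_; _,_)
open import Relation.Binary.PropositionalEquality using (_≡_)
open import Relation.Nullary using (¬_)
open import Algebra.Bundles using (CommutativeRing)

IsPrimePower : ℕ → Set
IsPrimePower q = Σ ℕ λ p → Σ ℕ λ k → Prime p × 1 ≤ k × q ≡ p N.^ k

module _ {c ℓ : Level} (K : CommutativeRing c ℓ) where
  open CommutativeRing K

  pow : Carrier → ℕ → Carrier
  pow x zero    = 1#
  pow x (suc n) = x * pow x n

  IsFieldCR : Set (c ⊔ ℓ)
  IsFieldCR = (¬ (1# ≈ 0#)) × (∀ x → ¬ (x ≈ 0#) → ∃ λ y → x * y ≈ 1#)

  HasCard : ℕ → Set (c ⊔ ℓ)
  HasCard n = Σ (Fin n → Carrier) λ f →
                (∀ i j → f i ≈ f j → i ≡ j) × (∀ x → ∃ λ i → f i ≈ x)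

  HasOrder : Carrier → ℕ → Set ℓ
  HasOrder α m = (pow α m ≈ 1#) × (∀ k → 0 < k → k < m → ¬ (pow α k ≈ 1#))

  TwoPrimitive : ℕ → Carrier → Set ℓ
  TwoPrimitive q α = HasOrder α ((q N.* q N.∸ 1) N./ 2)

  -- the subfield F_q of K (|K| = q²): fixed points of x ↦ x^q
  InFq : ℕ → Carrier → Set ℓ
  InFq q x = pow x q ≈ x

  -- α normal over F_q: α, α^q are F_q-linearly independent (a basis, as dim = 2)
  Normal : ℕ → Carrier → Set (c ⊔ ℓ)
  Normal q α = ∀ a b → InFq q a → InFq q b →
                 a * α + b * pow α q ≈ 0# → (a ≈ 0#) × (b ≈ 0#)

  -- α 1-normal over F_q: α, α^q span an F_q-space of dimension exactly 1,
  -- i.e. they are not both zero and are F_q-linearly dependent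
  OneNormal : ℕ → Carrier → Set (c ⊔ ℓ)
  OneNormal q α = (¬ ((α ≈ 0#) × (pow α q ≈ 0#))) ×
                  (∃ λ a → ∃ λ b → InFq q a × InFq q b ×
                     (¬ ((a ≈ 0#) × (b ≈ 0#))) × (a * α + b * pow α q ≈ 0#))

-- Write q = 2t + 1 and e = q - 1 = 2t, and let α have multiplicative order
-- m = (q² - 1)/2 = 2t(t + 1).  Then α is a unit and α^q = α·β with
-- β = α^e.  A relation a·α + b·α^q = 0 with a, b ∈ F_q (i.e. a^q = a,
-- b^q = b) gives a = -bβ; raising to the odd power q gives a = -bβ^q, hence
-- b(β^q - β) = 0.  Since β^q·β = α^{e(q+1)} = α^{2m} = 1, the equation
-- β^q = β would force α^{2e} = β² = 1, impossible when 0 < 4t < m, i.e. when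
-- t ≥ 2 (q > 3).  So b = 0 and then a = 0: α is normal.
-- For q = 3 the element α has order 4, so s = α² satisfies s² = 1, s ≠ 1,
-- hence s = -1 and α + α³ = α(1 + s) = 0: a nontrivial F_3-relation.
module Submission where

open import Defs
open import Level using (Level)
open import Data.Nat using (ℕ; _<_; _*_; _%_)
open import Data.Product using (_×_)
open import Relation.Binary.PropositionalEquality using (_≡_)
open import Algebra.Bundles using (CommutativeRing)

open import Data.Nat using (zero; suc; z≤n; s≤s; _∸_; _/_)
import Data.Nat as ℕ
import Data.Nat.Properties as ℕₚ
open import Data.Nat.DivMod using (m*n/n≡m; m≡m%n+[m/n]*n)
open import Data.Nat.Tactic.RingSolver using (solve-∀)
open import Data.Product using (_,_; proj₂)
open import Data.Maybe using (nothing)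
open import Relation.Nullary using (¬_)
import Relation.Binary.PropositionalEquality as P
open import Tactic.RingSolver.Core.AlmostCommutativeRing using (fromCommutativeRing)
import Tactic.RingSolver.NonReflective as RingSolver
import Algebra.Properties.Ring as RingProperties
import Algebra.Properties.CommutativeSemiring.Exp as Exp
import Relation.Binary.Reasoning.Setoid as SetoidReasoning

-- Arithmetic of q = 2t + 1, in its own module so that the natural-number
-- addition does not clash with the ring addition below.
module QArithmetic where
  open import Data.Nat using (_+_)

  odd⇒2t+1 : ∀ {q} → q % 2 ≡ 1 → q ≡ suc (q / 2 + q / 2)
  odd⇒2t+1 {q} q-odd = P.trans (m≡m%n+[m/n]*n q 2)
    (P.cong₂ _+_ q-odd (P.trans (ℕₚ.*-comm (q / 2) 2)
                                (P.cong (q / 2 +_) (ℕₚ.+-identityʳ (q / 2)))))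

  half-order : ∀ t → (suc (t + t) * suc (t + t) ∸ 1) / 2 ≡ t * suc t + t * suc t
  half-order t = P.trans (P.cong (_/ 2) (q²-1 t)) (m*n/n≡m (t * suc t + t * suc t) 2)
    where
    q²-1 : ∀ t → (t + t) + (t + t) * suc (t + t) ≡ (t * suc t + t * suc t) * 2
    q²-1 = solve-∀

  -- e(q + 1) = q² - 1 = 2m, written as e·q + e with e = 2t.
  e*q+e≡m+m : ∀ t → (t + t) * suc (t + t) + (t + t) ≡
                    (t * suc t + t * suc t) + (t * suc t + t * suc t)
  e*q+e≡m+m = solve-∀

  2e<m : ∀ s → let t = suc (suc s) in (t + t) + (t + t) < t * suc t + t * suc t
  2e<m s = P.subst ((t + t) + (t + t) <_) (P.sym (m≡2e+rest s))
                   (s≤s (ℕₚ.m≤m+n ((t + t) + (t + t)) _))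
    where
    t = suc (suc s)
    m≡2e+rest : ∀ s → let t = suc (suc s) in
                t * suc t + t * suc t ≡ suc (((t + t) + (t + t)) + (2 * s * s + 6 * s + 3))
    m≡2e+rest = solve-∀

open QArithmetic using (odd⇒2t+1; half-order; e*q+e≡m+m; 2e<m)

module _ {c ℓ : Level} (K : CommutativeRing c ℓ) where
  open CommutativeRing K renaming (_*_ to _·_)
  open RingProperties ring using (-‿distribˡ-*; -‿distribʳ-*; -‿involutive; -‿injective; +-inverseˡ-unique; x∙y⁻¹≈ε⇒x≈y; -0#≈0#)
  open Exp commutativeSemiring using (_^_; ^-homo-*; ^-assocʳ; ^-distrib-*; ^-congˡ)
  open RingSolver (fromCommutativeRing K (λ _ → nothing)) using (solve; _⊜_; _⊕_; _⊗_)
  open SetoidReasoning setoid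

  pow≈^ : ∀ x n → pow K x n ≈ x ^ n
  pow≈^ x zero    = refl
  pow≈^ x (suc n) = *-cong refl (pow≈^ x n)

  pow-cong : ∀ {x y} n → x ≈ y → pow K x n ≈ pow K y n
  pow-cong {x} {y} n x≈y = begin
    pow K x n ≈⟨ pow≈^ x n ⟩
    x ^ n     ≈⟨ ^-congˡ n x≈y ⟩
    y ^ n     ≈⟨ pow≈^ y n ⟨
    pow K y n ∎

  pow-+ : ∀ x m n → pow K x (m ℕ.+ n) ≈ pow K x m · pow K x n
  pow-+ x m n = begin
    pow K x (m ℕ.+ n)       ≈⟨ pow≈^ x (m ℕ.+ n) ⟩
    x ^ (m ℕ.+ n)           ≈⟨ ^-homo-* x m n ⟩
    x ^ m · x ^ n           ≈⟨ *-cong (pow≈^ x m) (pow≈^ x n) ⟨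
    pow K x m · pow K x n   ∎

  pow-assoc : ∀ x m n → pow K (pow K x m) n ≈ pow K x (m ℕ.* n)
  pow-assoc x m n = begin
    pow K (pow K x m) n ≈⟨ pow≈^ (pow K x m) n ⟩
    pow K x m ^ n       ≈⟨ ^-congˡ n (pow≈^ x m) ⟩
    (x ^ m) ^ n         ≈⟨ ^-assocʳ x m n ⟩
    x ^ (m ℕ.* n)       ≈⟨ pow≈^ x (m ℕ.* n) ⟨
    pow K x (m ℕ.* n)   ∎

  pow-distrib-* : ∀ x y n → pow K (x · y) n ≈ pow K x n · pow K y n
  pow-distrib-* x y n = begin
    pow K (x · y) n       ≈⟨ pow≈^ (x · y) n ⟩
    (x · y) ^ n           ≈⟨ ^-distrib-* x y n ⟩
    x ^ n · y ^ n         ≈⟨ *-cong (pow≈^ x n) (pow≈^ y n) ⟨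
    pow K x n · pow K y n ∎

  pow-cong-exp : ∀ x {m n} → m ≡ n → pow K x m ≈ pow K x n
  pow-cong-exp x m≡n = reflexive (P.cong (pow K x) m≡n)

  pow-double : ∀ x n → pow K x (n ℕ.+ n) ≈ pow K (x · x) n
  pow-double x n = trans (pow-+ x n n) (sym (pow-distrib-* x x n))

  -- Odd powers commute with negation; this is where q odd is used.
  pow-neg-odd : ∀ x n → pow K (- x) (suc (n ℕ.+ n)) ≈ - pow K x (suc (n ℕ.+ n))
  pow-neg-odd x n = begin
    - x · pow K (- x) (n ℕ.+ n)   ≈⟨ *-cong refl (pow-double (- x) n) ⟩
    - x · pow K (- x · - x) n     ≈⟨ *-cong refl (pow-cong n (neg-square x)) ⟩
    - x · pow K (x · x) n         ≈⟨ *-cong refl (pow-double x n) ⟨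
    - x · pow K x (n ℕ.+ n)       ≈⟨ -‿distribˡ-* x _ ⟨
    - (x · pow K x (n ℕ.+ n))     ∎
    where
    neg-square : ∀ x → - x · - x ≈ x · x
    neg-square x = begin
      - x · - x       ≈⟨ -‿distribˡ-* x (- x) ⟨
      - (x · - x)     ≈⟨ -‿cong (-‿distribʳ-* x x) ⟨
      - (- (x · x))   ≈⟨ -‿involutive (x · x) ⟩
      x · x           ∎

  pow-one : ∀ n → pow K 1# n ≈ 1#
  pow-one zero    = refl
  pow-one (suc n) = trans (*-identityˡ _) (pow-one n)

  unit-cancel : ∀ {u v x} → u · v ≈ 1# → u · x ≈ 0# → x ≈ 0#
  unit-cancel {u} {v} {x} uv≈1 ux≈0 = begin
    x             ≈⟨ *-identityˡ x ⟨
    1# · x        ≈⟨ *-cong (trans (sym uv≈1) (*-comm u v)) refl ⟩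
    (v · u) · x   ≈⟨ *-assoc v u x ⟩
    v · (u · x)   ≈⟨ *-cong refl ux≈0 ⟩
    v · 0#        ≈⟨ zeroʳ v ⟩
    0#            ∎

  field-cancel : IsFieldCR K → ∀ {u x} → ¬ (u ≈ 0#) → u · x ≈ 0# → x ≈ 0#
  field-cancel (_ , inverse) u≉0 ux≈0 = unit-cancel (proj₂ (inverse _ u≉0)) ux≈0

  cancel-distinct : IsFieldCR K → ∀ {x y z} → ¬ (x ≈ y) → x · z ≈ y · z → z ≈ 0#
  cancel-distinct isField {x} {y} {z} x≉y xz≈yz = field-cancel isField x-y≉0 (begin
    (x - y) · z         ≈⟨ distribʳ z x (- y) ⟩
    x · z + - y · z     ≈⟨ +-cong xz≈yz (sym (-‿distribˡ-* y z)) ⟩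
    y · z - y · z       ≈⟨ -‿inverseʳ (y · z) ⟩
    0#                  ∎)
    where
    x-y≉0 : ¬ (x - y ≈ 0#)
    x-y≉0 x-y≈0 = x≉y (x∙y⁻¹≈ε⇒x≈y x y x-y≈0)

  square-root-of-one : IsFieldCR K → ∀ {s} → s · s ≈ 1# → ¬ (s ≈ 1#) → s + 1# ≈ 0#
  square-root-of-one isField {s} ss≈1 s≉1 = cancel-distinct isField s≉1 (begin
    s · (s + 1#)       ≈⟨ distribˡ s s 1# ⟩
    s · s + s · 1#     ≈⟨ +-cong ss≈1 (*-identityʳ s) ⟩
    1# + s             ≈⟨ +-comm 1# s ⟩
    s + 1#             ≈⟨ *-identityˡ (s + 1#) ⟨
    1# · (s + 1#)      ∎)

  -- Normality criterion.  For q = 2t + 1 and a unit α, put β = α^{q-1}, so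
  -- that α^q = α·β.  If β is not fixed by x ↦ x^q, then α is normal.
  normal-if-moved : IsFieldCR K → ∀ t α {v} → α · v ≈ 1# →
                    ¬ (pow K (pow K α (t ℕ.+ t)) (suc (t ℕ.+ t)) ≈ pow K α (t ℕ.+ t)) →
                    Normal K (suc (t ℕ.+ t)) α
  normal-if-moved isField t α αv≈1 β-moved a b a-fixed b-fixed relation = a≈0 , b≈0
    where
    q = suc (t ℕ.+ t)
    β = pow K α (t ℕ.+ t)

    factor : ∀ a b α β → α · (a + b · β) ≈ a · α + b · (α · β)
    factor = solve 4 (λ a b α β → (α ⊗ (a ⊕ b ⊗ β)) ⊜ (a ⊗ α ⊕ b ⊗ (α ⊗ β))) refl

    -- the relation a·α + b·α^q = 0 is α·(a + bβ) = 0, and α is a unit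
    a≈-bβ : a ≈ - (b · β)
    a≈-bβ = +-inverseˡ-unique a (b · β) (unit-cancel αv≈1 (trans (factor a b α β) relation))

    -- x ↦ x^q fixes a and b and, q being odd, commutes with negation
    a≈-bβ^q : a ≈ - (b · pow K β q)
    a≈-bβ^q = begin
      a                         ≈⟨ a-fixed ⟨
      pow K a q                 ≈⟨ pow-cong q a≈-bβ ⟩
      pow K (- (b · β)) q       ≈⟨ pow-neg-odd (b · β) t ⟩
      - pow K (b · β) q         ≈⟨ -‿cong (pow-distrib-* b β q) ⟩
      - (pow K b q · pow K β q) ≈⟨ -‿cong (*-cong b-fixed refl) ⟩
      - (b · pow K β q)         ∎

    b≈0 : b ≈ 0#
    b≈0 = cancel-distinct isField β-moved (begin
      pow K β q · b ≈⟨ *-comm _ b ⟩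
      b · pow K β q ≈⟨ -‿injective (trans (sym a≈-bβ^q) a≈-bβ) ⟩
      b · β         ≈⟨ *-comm b β ⟩
      β · b         ∎)

    a≈0 : a ≈ 0#
    a≈0 = begin
      a           ≈⟨ a≈-bβ ⟩
      - (b · β)   ≈⟨ -‿cong (*-cong b≈0 refl) ⟩
      - (0# · β)  ≈⟨ -‿cong (zeroˡ β) ⟩
      - 0#        ≈⟨ -0#≈0# ⟩
      0#          ∎

  -- With q = 2t + 1, e = 2t and m = 2t(t + 1): if α^m = 1, then β = α^e has
  -- β^q·β = α^{e(q+1)} = α^{2m} = 1, so a fixed β would give α^{2e} = β² = 1.
  fixed⇒α^2e≈1 : ∀ t α → pow K α (t ℕ.* suc t ℕ.+ t ℕ.* suc t) ≈ 1# →
                 pow K (pow K α (t ℕ.+ t)) (suc (t ℕ.+ t)) ≈ pow K α (t ℕ.+ t) →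
                 pow K α ((t ℕ.+ t) ℕ.+ (t ℕ.+ t)) ≈ 1#
  fixed⇒α^2e≈1 t α α^m≈1 β-fixed = begin
    pow K α (e ℕ.+ e)              ≈⟨ pow-+ α e e ⟩
    β · β                          ≈⟨ *-cong β-fixed refl ⟨
    pow K β q · β                  ≈⟨ *-cong (pow-assoc α e q) refl ⟩
    pow K α (e ℕ.* q) · β          ≈⟨ pow-+ α (e ℕ.* q) e ⟨
    pow K α (e ℕ.* q ℕ.+ e)        ≈⟨ pow-cong-exp α (e*q+e≡m+m t) ⟩
    pow K α (m ℕ.+ m)              ≈⟨ pow-+ α m m ⟩
    pow K α m · pow K α m          ≈⟨ *-cong α^m≈1 α^m≈1 ⟩
    1# · 1#                        ≈⟨ *-identityˡ 1# ⟩
    1#                             ∎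
    where
    e = t ℕ.+ t
    q = suc e
    m = t ℕ.* suc t ℕ.+ t ℕ.* suc t
    β = pow K α e

  twoPrimitive⇒normal : IsFieldCR K → ∀ t → 3 < suc (t ℕ.+ t) →
                        ∀ α → TwoPrimitive K (suc (t ℕ.+ t)) α → Normal K (suc (t ℕ.+ t)) α
  twoPrimitive⇒normal _ zero (s≤s ())
  twoPrimitive⇒normal _ (suc zero) (s≤s (s≤s (s≤s ())))
  twoPrimitive⇒normal isField t@(suc (suc s)) _ α (α^order≈1 , minimal) =
    normal-if-moved isField t α α^m≈1 λ β-fixed →
      minimal (e ℕ.+ e) (s≤s z≤n) 2e<order (fixed⇒α^2e≈1 t α α^m≈1 β-fixed)
    where
    e = t ℕ.+ t
    -- α^m unfolds to α·α^{m-1}, so this also exhibits α as a unit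
    α^m≈1 : pow K α (t ℕ.* suc t ℕ.+ t ℕ.* suc t) ≈ 1#
    α^m≈1 = trans (pow-cong-exp α (P.sym (half-order t))) α^order≈1
    2e<order : e ℕ.+ e < (suc e ℕ.* suc e ∸ 1) / 2
    2e<order = P.subst (e ℕ.+ e <_) (P.sym (half-order t)) (2e<m s)

  twoPrimitive⇒oneNormal : IsFieldCR K → ∀ α → TwoPrimitive K 3 α → OneNormal K 3 α
  twoPrimitive⇒oneNormal isField@(1≉0 , _) α (α⁴≈1 , minimal) =
    α≉0 , 1# , 1# , pow-one 3 , pow-one 3 , (λ (1≈0 , _) → 1≉0 1≈0) , relation
    where
    s = α · α
    s≈α² : s ≈ pow K α 2
    s≈α² = *-cong refl (sym (*-identityʳ α))
    s²≈1 : s · s ≈ 1#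
    s²≈1 = trans (trans (*-cong refl (sym (*-identityʳ s))) (sym (pow-double α 2))) α⁴≈1
    s+1≈0 : s + 1# ≈ 0#
    s+1≈0 = square-root-of-one isField s²≈1
              (λ s≈1 → minimal 2 (s≤s z≤n) (s≤s (s≤s (s≤s z≤n))) (trans (sym s≈α²) s≈1))
    α≉0 : ¬ ((α ≈ 0#) × (pow K α 3 ≈ 0#))
    α≉0 (α≈0 , _) = 1≉0 (trans (sym α⁴≈1) (trans (*-cong α≈0 refl) (zeroˡ _)))
    relation : 1# · α + 1# · pow K α 3 ≈ 0#
    relation = begin
      1# · α + 1# · pow K α 3   ≈⟨ +-cong (*-identityˡ α) (*-identityˡ _) ⟩
      α + α · (α · (α · 1#))    ≈⟨ +-cong (sym (*-identityʳ α)) (*-cong refl (*-cong refl (*-identityʳ α))) ⟩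
      α · 1# + α · s            ≈⟨ +-comm _ _ ⟩
      α · s + α · 1#            ≈⟨ distribˡ α s 1# ⟨
      α · (s + 1#)              ≈⟨ *-cong refl s+1≈0 ⟩
      α · 0#                    ≈⟨ zeroʳ α ⟩
      0#                        ∎

lemma4 : ∀ {c ℓ : Level} (K : CommutativeRing c ℓ) → IsFieldCR K →
           (q : ℕ) → IsPrimePower q → q % 2 ≡ 1 → HasCard K (q * q) →
           ((3 < q → ∀ α → TwoPrimitive K q α → Normal K q α) ×
            (q ≡ 3 → ∀ α → TwoPrimitive K q α → OneNormal K q α))
lemma4 K isField q _ q-odd _ = normal-case , one-normal-case
  where
  normal-case : 3 < q → ∀ α → TwoPrimitive K q α → Normal K q α
  normal-case = P.subst (λ n → 3 < n → ∀ α → TwoPrimitive K n α → Normal K n α)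
                        (P.sym (odd⇒2t+1 q-odd)) (twoPrimitive⇒normal K isField (q / 2))
  one-normal-case : q ≡ 3 → ∀ α → TwoPrimitive K q α → OneNormal K q α
  one-normal-case q≡3 = P.subst (λ n → ∀ α → TwoPrimitive K n α → OneNormal K n α)
                                (P.sym q≡3) (twoPrimitive⇒oneNormal K isField)
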